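{- Let $G=(V,E)$ be a connected claw-free graph and let $uv\in E$ with $u$ a leaf (vertex of degree $1$). Then there exists a minimum dominating set $\Gamma$ of $G$ of the form $\Gamma=\{v\}\cup\Gamma'$, where $\Gamma'$ is a minimum dominating set of $G'=G-N[v]$.
   Context: Graphs are finite, simple, undirected. The claw is $K_{1,3}$; claw-free means no induced subgraph isomorphic to $K_{1,3}$. $N[v]$ is the closed neighborhood of $v$, and $G-N[v]$ is the subgraph induced by $V\setminus N[v]$. A dominating set is a set $D$ such that every vertex is in $D$ or adjacent to a vertex of $D$; a minimum dominating set has minimum cardinality. -}

module Defs where

open import Data.Nat using (ℕ; _≤_)
open import Data.Bool using (Bool; true; false)
open import Data.Fin using (Fin)
open import Data.Fin.Subset using (Subset; ⁅_⁆; _∪_; _∈_; _∉_; _⊆_; ∣_∣; ∁)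
open import Data.Vec using (tabulate)
open import Data.Product using (_×_)
open import Data.Sum using (_⊎_)
open import Data.Empty using (⊥)
open import Relation.Nullary using (¬_)
open import Relation.Binary.PropositionalEquality using (_≡_)

record Graph (n : ℕ) : Set where
  field
    adj     : Fin n → Fin n → Bool
    symm    : ∀ x y → adj x y ≡ adj y x
    irrefl  : ∀ x → adj x x ≡ false

module _ {n : ℕ} (G : Graph n) where
  open Graph G

  E : Fin n → Fin n → Set
  E x y = adj x y ≡ true

  N : Fin n → Subset n
  N v = tabulate (adj v)

  N[_] : Fin n → Subset n
  N[ v ] = ⁅ v ⁆ ∪ N v

  degree : Fin n → ℕ
  degree v = ∣ N v ∣

  data Reach : Fin n → Fin n → Set where
    here : ∀ {x} → Reach x x
    step : ∀ {x y z} → E x y → Reach y z → Reach x z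

  Connected : Set
  Connected = ∀ x y → Reach x y

  ClawFree : Set
  ClawFree = ∀ (a b c d : Fin n) →
    ¬ ( E a b × E a c × E a d
      × ¬ b ≡ c × ¬ b ≡ d × ¬ c ≡ d
      × ¬ E b c × ¬ E b d × ¬ E c d )

  -- D is a dominating set of the induced subgraph G[S]:
  -- D ⊆ S and every vertex of S is in D or adjacent to a vertex of D.
  -- (Adjacency in G[S] between vertices of S is adjacency in G.)
  DominatingIn : Subset n → Subset n → Set
  DominatingIn S D = D ⊆ S × (∀ x → x ∈ S → x ∈ D ⊎ (∃D x))
    where
      ∃D : Fin n → Set
      ∃D x = Data.Product.Σ (Fin n) (λ y → y ∈ D × E x y)

  MinDominatingIn : Subset n → Subset n → Set
  MinDominatingIn S D =
    DominatingIn S D × (∀ D′ → DominatingIn S D′ → ∣ D ∣ ≤ ∣ D′ ∣)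

  V : Subset n
  V = tabulate (λ _ → true)

  Dominating : Subset n → Set
  Dominating = DominatingIn V

  MinDominating : Subset n → Set
  MinDominating = MinDominatingIn V

  V-N[_] : Fin n → Subset n
  V-N[ v ] = ∁ N[ v ]

-- Let u be a leaf with neighbour v and S = V ∖ N[v].  For a dominating set D
-- of G, project every vertex x onto S: x itself if x ∈ S, otherwise some
-- neighbour of x in S if there is one, and v otherwise.  The "shadow"
-- h(D) ∩ S of D dominates G[S]: a vertex x ∈ S dominated by some y ∈ N(v)
-- is dominated by the projection a of y, since otherwise y, v, x, a would
-- form an induced claw.  Moreover v ∈ h(D), because u is dominated by u or
-- by v, both of which project to v; as v ∉ S we get 1 + |shadow| ≤ |D|.
-- So if Γ′ is a minimum dominating set of G[S], then {v} ∪ Γ′ dominates G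
-- and |{v} ∪ Γ′| ≤ 1 + |Γ′| ≤ 1 + |shadow D| ≤ |D| for every dominating D.

module Submission where

open import Defs
open import Data.Nat using (ℕ; suc; _+_; _≤_; _<_; _<?_; z≤n; s≤s)
open import Data.Nat.Properties
  using (≤-trans; <-irrefl; m≤n⇒m≤1+n; +-suc; ≮⇒≥; module ≤-Reasoning)
open import Data.Nat.Induction using (<-wellFounded)
open import Induction.WellFounded using (Acc; acc)
open import Data.Fin using (Fin; zero; suc; _≟_)
open import Data.Fin.Properties using (all?; any?)
open import Data.Fin.Subset
  using (Subset; ⁅_⁆; _∪_; _∩_; _∈_; _∉_; _⊆_; _⊂_; ∣_∣; ∁; ⊥)
open import Data.Fin.Subset.Properties
  using ( _∈?_; _⊆?_; anySubset?; x∈p∪q⁺; x∈p∪q⁻; x∈p∩q⁺; x∈p∩q⁻; p∩q⊆p; p∩q⊆q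
        ; x∈⁅x⁆; x∈⁅y⁆⇒x≡y; ∣⁅x⁆∣≡1; ∣⊥∣≡0; p⊂q⇒∣p∣<∣q∣
        ; x∈∁p⇒x∉p; x∉p⇒x∈∁p )
open import Data.Bool using (true; false)
import Data.Bool.Properties as Bool
open import Data.Vec using (_∷_; []; tabulate; here; there)
open import Data.Vec.Properties using (lookup⇒[]=; []=⇒lookup; lookup∘tabulate)
open import Data.Product using (Σ; ∃; _×_; _,_; proj₂)
open import Data.Sum using (_⊎_; inj₁; inj₂)
open import Data.Empty using (⊥-elim)
open import Relation.Nullary using (¬_; yes; no)
open import Relation.Nullary.Decidable using (_×-dec_; _⊎-dec_; _→-dec_)
open import Relation.Unary using (Decidable)
open import Relation.Binary.PropositionalEquality
  using (_≡_; refl; sym; trans; subst; subst₂)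
open import Function using (_∘_; id)

∣p∪q∣≤∣p∣+∣q∣ : ∀ {n} (p q : Subset n) → ∣ p ∪ q ∣ ≤ ∣ p ∣ + ∣ q ∣
∣p∪q∣≤∣p∣+∣q∣ []          []          = z≤n
∣p∪q∣≤∣p∣+∣q∣ (true ∷ p)  (true ∷ q)  rewrite +-suc ∣ p ∣ ∣ q ∣ =
  s≤s (m≤n⇒m≤1+n (∣p∪q∣≤∣p∣+∣q∣ p q))
∣p∪q∣≤∣p∣+∣q∣ (true ∷ p)  (false ∷ q) = s≤s (∣p∪q∣≤∣p∣+∣q∣ p q)
∣p∪q∣≤∣p∣+∣q∣ (false ∷ p) (true ∷ q)  rewrite +-suc ∣ p ∣ ∣ q ∣ =
  s≤s (∣p∪q∣≤∣p∣+∣q∣ p q)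
∣p∪q∣≤∣p∣+∣q∣ (false ∷ p) (false ∷ q) = ∣p∪q∣≤∣p∣+∣q∣ p q

∣⁅x⁆∪p∣≤1+∣p∣ : ∀ {n} (x : Fin n) (p : Subset n) → ∣ ⁅ x ⁆ ∪ p ∣ ≤ suc ∣ p ∣
∣⁅x⁆∪p∣≤1+∣p∣ x p with ∣p∪q∣≤∣p∣+∣q∣ ⁅ x ⁆ p
... | bound rewrite ∣⁅x⁆∣≡1 x = bound

image : ∀ {n m} → (Fin n → Fin m) → Subset n → Subset m
image f []          = ⊥
image f (true ∷ p)  = ⁅ f zero ⁆ ∪ image (f ∘ suc) p
image f (false ∷ p) = image (f ∘ suc) p

∈-image : ∀ {n m} (f : Fin n → Fin m) (p : Subset n) {x} → x ∈ p → f x ∈ image f p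
∈-image f (true ∷ p)  here     = x∈p∪q⁺ (inj₁ (x∈⁅x⁆ (f zero)))
∈-image f (true ∷ p)  (there x∈p) =
  x∈p∪q⁺ {p = ⁅ f zero ⁆} (inj₂ (∈-image (f ∘ suc) p x∈p))
∈-image f (false ∷ p) (there x∈p) = ∈-image (f ∘ suc) p x∈p

∣image∣≤ : ∀ {n m} (f : Fin n → Fin m) (p : Subset n) → ∣ image f p ∣ ≤ ∣ p ∣
∣image∣≤ {m = m} f [] rewrite ∣⊥∣≡0 m = z≤n
∣image∣≤ f (true ∷ p)  =
  ≤-trans (∣⁅x⁆∪p∣≤1+∣p∣ (f zero) (image (f ∘ suc) p)) (s≤s (∣image∣≤ (f ∘ suc) p))
∣image∣≤ f (false ∷ p) = ∣image∣≤ (f ∘ suc) p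

IsMinimum : ∀ {n} → (Subset n → Set) → Subset n → Set
IsMinimum P D = P D × (∀ D′ → P D′ → ∣ D ∣ ≤ ∣ D′ ∣)

minimum-exists : ∀ {n} (P : Subset n → Set) → Decidable P →
                 ∀ D → P D → Σ (Subset n) (IsMinimum P)
minimum-exists P P? D pD = descend (<-wellFounded ∣ D ∣) pD
  where
  descend : ∀ {D} → Acc _<_ ∣ D ∣ → P D → Σ (Subset _) (IsMinimum P)
  descend {D} (acc smaller) pD with anySubset? (λ D′ → P? D′ ×-dec (∣ D′ ∣ <? ∣ D ∣))
  ... | yes (D′ , pD′ , D′<D) = descend (smaller D′<D) pD′
  ... | no none = D , pD , λ D′ pD′ → ≮⇒≥ (λ D′<D → none (D′ , pD′ , D′<D))

module _ {n : ℕ} (G : Graph n) where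
  open Graph G

  E-sym : ∀ {x y} → E G x y → E G y x
  E-sym {x} {y} xy = trans (symm y x) xy

  E⇒∈N : ∀ {w x} → E G w x → x ∈ N G w
  E⇒∈N {w} {x} wx = lookup⇒[]= x (tabulate (adj w)) (trans (lookup∘tabulate (adj w) x) wx)

  ∈N⇒E : ∀ {w x} → x ∈ N G w → E G w x
  ∈N⇒E {w} {x} x∈N = trans (sym (lookup∘tabulate (adj w) x)) ([]=⇒lookup x∈N)

  ∈V : ∀ x → x ∈ V G
  ∈V x = lookup⇒[]= x (tabulate (λ _ → true)) (lookup∘tabulate (λ _ → true) x)

  ∈V-N[v]⇒≢v : ∀ {v x} → x ∈ V-N[_] G v → ¬ x ≡ v
  ∈V-N[v]⇒≢v {v} x∈S refl = x∈∁p⇒x∉p x∈S (x∈p∪q⁺ (inj₁ (x∈⁅x⁆ v)))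

  ∈V-N[v]⇒¬E : ∀ {v x} → x ∈ V-N[_] G v → ¬ E G v x
  ∈V-N[v]⇒¬E {v} x∈S vx = x∈∁p⇒x∉p x∈S (x∈p∪q⁺ {p = ⁅ v ⁆} (inj₂ (E⇒∈N vx)))

  ∉V-N[v]⇒N[v] : ∀ {v x} → x ∉ V-N[_] G v → x ≡ v ⊎ E G v x
  ∉V-N[v]⇒N[v] {v} {x} x∉S with x ∈? N[_] G v
  ... | no x∉N[v] = ⊥-elim (x∉S (x∉p⇒x∈∁p x∉N[v]))
  ... | yes x∈N[v] with x∈p∪q⁻ ⁅ v ⁆ (N G v) x∈N[v]
  ...   | inj₁ x∈⁅v⁆ = inj₁ (x∈⁅y⁆⇒x≡y v x∈⁅v⁆)
  ...   | inj₂ x∈N   = inj₂ (∈N⇒E x∈N)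

  leaf-neighbour : ∀ {u v y} → degree G u ≡ 1 → E G u v → E G u y → y ≡ v
  leaf-neighbour {u} {v} {y} deg uv uy with y ≟ v
  ... | yes y≡v = y≡v
  ... | no y≢v = ⊥-elim (<-irrefl refl (subst₂ _<_ (∣⁅x⁆∣≡1 v) deg (p⊂q⇒∣p∣<∣q∣ ⁅v⁆⊂N[u])))
    where
    ⁅v⁆⊂N[u] : ⁅ v ⁆ ⊂ N G u
    ⁅v⁆⊂N[u] = (λ z∈⁅v⁆ → subst (_∈ N G u) (sym (x∈⁅y⁆⇒x≡y v z∈⁅v⁆)) (E⇒∈N uv))
             , y , E⇒∈N uy , y≢v ∘ x∈⁅y⁆⇒x≡y v

  dominatingIn? : ∀ S → Decidable (DominatingIn G S)
  dominatingIn? S D = (D ⊆? S) ×-dec all? (λ x → (x ∈? S) →-dec ((x ∈? D) ⊎-dec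
    any? (λ y → (y ∈? D) ×-dec (adj x y Bool.≟ true))))

  minDominating-exists : ∀ S → Σ (Subset n) (MinDominatingIn G S)
  minDominating-exists S =
    minimum-exists (DominatingIn G S) (dominatingIn? S) S (id , λ _ x∈S → inj₁ x∈S)

  add-centre : ∀ {v Γ′} → DominatingIn G (V-N[_] G v) Γ′ → Dominating G (⁅ v ⁆ ∪ Γ′)
  add-centre {v} {Γ′} (_ , Γ′-dom) = (λ {x} _ → ∈V x) , λ x _ → dominated x
    where
    v∈ : v ∈ ⁅ v ⁆ ∪ Γ′
    v∈ = x∈p∪q⁺ (inj₁ (x∈⁅x⁆ v))
    Γ′⊆ : Γ′ ⊆ ⁅ v ⁆ ∪ Γ′
    Γ′⊆ x∈Γ′ = x∈p∪q⁺ {p = ⁅ v ⁆} (inj₂ x∈Γ′)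
    dominated : ∀ x → x ∈ ⁅ v ⁆ ∪ Γ′ ⊎ Σ (Fin n) (λ y → y ∈ ⁅ v ⁆ ∪ Γ′ × E G x y)
    dominated x with x ∈? V-N[_] G v
    ... | yes x∈S with Γ′-dom x x∈S
    ...   | inj₁ x∈Γ′             = inj₁ (Γ′⊆ x∈Γ′)
    ...   | inj₂ (y , y∈Γ′ , xy)  = inj₂ (y , Γ′⊆ y∈Γ′ , xy)
    dominated x | no x∉S with ∉V-N[v]⇒N[v] x∉S
    ...   | inj₁ refl = inj₁ v∈
    ...   | inj₂ vx   = inj₂ (v , v∈ , E-sym vx)

module Projection {n : ℕ} (G : Graph n) (claw-free : ClawFree G) (v : Fin n) where
  open Graph G

  S : Subset n
  S = V-N[_] G v

  HasNeighbourInS : Fin n → Set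
  HasNeighbourInS x = ∃ λ a → a ∈ S × E G x a

  hasNeighbourInS? : Decidable HasNeighbourInS
  hasNeighbourInS? x = any? (λ a → (a ∈? S) ×-dec (adj x a Bool.≟ true))

  project : Fin n → Fin n
  project x with x ∈? S | hasNeighbourInS? x
  ... | yes _ | _           = x
  ... | no _  | yes (a , _) = a
  ... | no _  | no _        = v

  project-inside : ∀ {x} → x ∈ S → project x ≡ x
  project-inside {x} x∈S with x ∈? S | hasNeighbourInS? x
  ... | yes _   | _ = refl
  ... | no x∉S  | _ = ⊥-elim (x∉S x∈S)

  project-toward : ∀ {x} → x ∉ S → HasNeighbourInS x →
                   project x ∈ S × E G x (project x)
  project-toward {x} x∉S has with x ∈? S | hasNeighbourInS? x
  ... | yes x∈S | _                  = ⊥-elim (x∉S x∈S)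
  ... | no _    | yes (_ , a∈S , xa) = a∈S , xa
  ... | no _    | no hasn't          = ⊥-elim (hasn't has)

  project-outside : ∀ {x} → x ∉ S → ¬ HasNeighbourInS x → project x ≡ v
  project-outside {x} x∉S hasn't with x ∈? S | hasNeighbourInS? x
  ... | yes x∈S | _       = ⊥-elim (x∉S x∈S)
  ... | no _    | yes has = ⊥-elim (hasn't has)
  ... | no _    | no _    = refl

  -- Key step (claw-freeness): a vertex y ∈ N(v) adjacent to x ∈ S projects
  -- onto x or onto a neighbour of x; otherwise y, v, x, project y is a claw.
  project-near : ∀ {x y} → x ∈ S → y ∉ S → E G y x →
                 project y ∈ S × (project y ≡ x ⊎ E G x (project y))
  project-near {x} {y} x∈S y∉S yx with project-toward y∉S (x , x∈S , yx)
  ... | a∈S , ya with project y ≟ x | adj x (project y) Bool.≟ true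
  ...   | yes a≡x | _       = a∈S , inj₁ a≡x
  ...   | no _    | yes xa  = a∈S , inj₂ xa
  ...   | no a≢x  | no ¬xa with ∉V-N[v]⇒N[v] G y∉S
  ...     | inj₁ refl = ⊥-elim (∈V-N[v]⇒¬E G x∈S yx)
  ...     | inj₂ vy   = ⊥-elim (claw-free y v x (project y)
              ( E-sym G vy , yx , ya
              , ∈V-N[v]⇒≢v G x∈S ∘ sym , ∈V-N[v]⇒≢v G a∈S ∘ sym , a≢x ∘ sym
              , ∈V-N[v]⇒¬E G x∈S , ∈V-N[v]⇒¬E G a∈S , ¬xa ))

  shadow : Subset n → Subset n
  shadow D = image project D ∩ S

  ∈-shadow : ∀ {D x} → x ∈ D → project x ∈ S → project x ∈ shadow D
  ∈-shadow {D} x∈D px∈S = x∈p∩q⁺ (∈-image project D x∈D , px∈S)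

  ∈S⇒∈shadow : ∀ {D x} → x ∈ D → x ∈ S → x ∈ shadow D
  ∈S⇒∈shadow {D} {x} x∈D x∈S = x∈p∩q⁺ (∈-image-inside , x∈S)
    where
    ∈-image-inside : x ∈ image project D
    ∈-image-inside = subst (_∈ image project D) (project-inside x∈S) (∈-image project D x∈D)

  shadow-dominates : ∀ D → Dominating G D → DominatingIn G S (shadow D)
  shadow-dominates D (_ , D-dom) = p∩q⊆q (image project D) S , λ x x∈S → dominated x x∈S (D-dom x (∈V G x))
    where
    dominated : ∀ x → x ∈ S → x ∈ D ⊎ Σ (Fin n) (λ y → y ∈ D × E G x y) →
                x ∈ shadow D ⊎ Σ (Fin n) (λ y → y ∈ shadow D × E G x y)
    dominated x x∈S (inj₁ x∈D) = inj₁ (∈S⇒∈shadow x∈D x∈S)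
    dominated x x∈S (inj₂ (y , y∈D , xy)) with y ∈? S
    ... | yes y∈S = inj₂ (y , ∈S⇒∈shadow y∈D y∈S , xy)
    ... | no y∉S with project-near x∈S y∉S (E-sym G xy)
    ...   | py∈S , inj₁ py≡x = inj₁ (subst (_∈ shadow D) py≡x (∈-shadow y∈D py∈S))
    ...   | py∈S , inj₂ x~py = inj₂ (project y , ∈-shadow y∈D py∈S , x~py)

  shadow-smaller : ∀ D → v ∈ image project D → suc ∣ shadow D ∣ ≤ ∣ D ∣
  shadow-smaller D v∈img = ≤-trans (p⊂q⇒∣p∣<∣q∣ shadow⊂image) (∣image∣≤ project D)
    where
    shadow⊂image : shadow D ⊂ image project D
    shadow⊂image = p∩q⊆p (image project D) S , v , v∈img
                 , λ v∈shadow → ∈V-N[v]⇒≢v G (proj₂ (x∈p∩q⁻ (image project D) S v∈shadow)) refl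

  -- If u is a leaf at v, every dominating set contains u or v, and both project to v.
  leaf-projects-to-centre : ∀ {u} → E G u v → degree G u ≡ 1 →
                            ∀ D → Dominating G D → v ∈ image project D
  leaf-projects-to-centre {u} uv deg D (_ , D-dom) with D-dom u (∈V G u)
  ... | inj₁ u∈D = subst (_∈ image project D) (project-outside u∉S no-neighbour) (∈-image project D u∈D)
    where
    u∉S : u ∉ S
    u∉S u∈S = ∈V-N[v]⇒¬E G u∈S (E-sym G uv)
    no-neighbour : ¬ HasNeighbourInS u
    no-neighbour (a , a∈S , ua) = ∈V-N[v]⇒≢v G a∈S (leaf-neighbour G deg uv ua)
  ... | inj₂ (y , y∈D , uy) with leaf-neighbour G deg uv uy
  ...   | refl = subst (_∈ image project D) (project-outside v∉S no-neighbour) (∈-image project D y∈D)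
    where
    v∉S : v ∉ S
    v∉S v∈S = ∈V-N[v]⇒≢v G v∈S refl
    no-neighbour : ¬ HasNeighbourInS v
    no-neighbour (a , a∈S , va) = ∈V-N[v]⇒¬E G a∈S va

mainTheorem3 : ∀ {n : ℕ} (G : Graph n) → Connected G → ClawFree G →
    ∀ (u v : Fin n) → E G u v → degree G u ≡ 1 →
    Σ (Subset n) λ Γ′ →
    MinDominatingIn G (V-N[_] G v) Γ′ × MinDominating G (⁅ v ⁆ ∪ Γ′)
mainTheorem3 G _ claw-free u v uv deg with minDominating-exists G (V-N[_] G v)
... | Γ′ , Γ′-dom , Γ′-min = Γ′ , (Γ′-dom , Γ′-min) , add-centre G Γ′-dom , minimum
  where
  open Projection G claw-free v
  open ≤-Reasoning
  minimum : ∀ D → Dominating G D → ∣ ⁅ v ⁆ ∪ Γ′ ∣ ≤ ∣ D ∣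
  minimum D D-dom = begin
    ∣ ⁅ v ⁆ ∪ Γ′ ∣     ≤⟨ ∣⁅x⁆∪p∣≤1+∣p∣ v Γ′ ⟩
    suc ∣ Γ′ ∣         ≤⟨ s≤s (Γ′-min (shadow D) (shadow-dominates D D-dom)) ⟩
    suc ∣ shadow D ∣   ≤⟨ shadow-smaller D (leaf-projects-to-centre uv deg D D-dom) ⟩
    ∣ D ∣              ∎
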